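{- Let $p,q$ be primes with $2<p<q$ and $\kappa+\lambda<p$. Then $g_2$ is not representable.
   Context: Let $p,q$ be primes with $2<p<q$, and put $p'=(p-1)/2$, $q'=(q-1)/2$. Set $d_0=pq$, $d_1=p'q$, $d_2=pq'$, $d_3=(pq-1)/2$, and for integers $x,y,z,w$ put $f(x,y,z,w)=xd_0+yd_1+zd_2+wd_3$. An integer is representable if it equals $f(x,y,z,w)$ for some nonnegative integers $x,y,z,w$. Define $\kappa,\lambda$ by $q=\kappa p+\lambda$ with $1\le\lambda\le p-1$, and put $g_0=f(p'-1,p-1,\kappa,-1)$ and $g_2=g_0-(p-3)d_3$. -}

module Defs where

open import Data.Nat as ℕ using (ℕ; _∸_; _/_)
open import Data.Integer using (ℤ; +_; _+_; _-_; _*_; -[1+_])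
open import Data.Product using (∃; _,_)
open import Relation.Binary.PropositionalEquality using (_≡_)

-- p' = (p-1)/2, q' = (q-1)/2 (exact for odd primes)
p′ : ℕ → ℕ
p′ p = (p ∸ 1) / 2

d₀ d₁ d₂ d₃ : ℕ → ℕ → ℤ
d₀ p q = + (p ℕ.* q)
d₁ p q = + (p′ p ℕ.* q)
d₂ p q = + (p ℕ.* p′ q)
d₃ p q = + ((p ℕ.* q ∸ 1) / 2)

f : ℕ → ℕ → ℤ → ℤ → ℤ → ℤ → ℤ
f p q x y z w = x * d₀ p q + y * d₁ p q + z * d₂ p q + w * d₃ p q

Representable : ℕ → ℕ → ℤ → Set
Representable p q n =
  ∃ λ (x : ℕ) → ∃ λ (y : ℕ) → ∃ λ (z : ℕ) → ∃ λ (w : ℕ) →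
    f p q (+ x) (+ y) (+ z) (+ w) ≡ n

g₀ : ℕ → ℕ → ℕ → ℤ
g₀ p q κ = f p q (+ p′ p - + 1) (+ p - + 1) (+ κ) -[1+ 0 ]

g₂ : ℕ → ℕ → ℕ → ℤ
g₂ p q κ = g₀ p q κ - (+ p - + 3) * d₃ p q

module Submission where

-- Adding (p - 2)d₃ to a representation g₂ = f(x,y,z,w) gives two
-- representations with nonnegative coefficients of one number,
-- f(x,y,z,w + p - 2) = f(p' - 1, p - 1, κ, 0).  Doubling clears the halves in d₁, d₂, d₃
-- and turns this into q A + c = q A₀ + B with A = 2px + (p-1)y + pz + pw, B = pz + w,
-- A₀ = (p-1)² + (κ-1)p and c = (κ-1)p + 2 < q.  So A = A₀ + t and B = qt + c for some t ≥ 0.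
-- As A + y ≡ 0 and A₀ ≡ 1 (mod p), we get t + y ≥ p - 1, whence
-- A ≥ (p-1)y + B ≥ (p-1)(y + t) + t + c ≥ (p-1)² + t + c = A₀ + t + 2 > A.

open import Defs
open import Data.Nat using (ℕ; _+_; _*_; _∸_; _≤_; _<_)
open import Data.Nat.Primality using (Prime)
open import Relation.Binary.PropositionalEquality using (_≡_)
open import Relation.Nullary using (¬_)

open import Data.Nat.Base using (zero; suc; z≤n; s≤s; s≤s⁻¹; _/_; _%_)
open import Data.Nat.Properties
open import Data.Nat.DivMod using (m≡m%n+[m/n]*n; m%n<n; m*n/n≡m)
open import Data.Nat.Divisibility using (divides; ∣m+n∣m⇒∣n; m∣m*n; ∣⇒≤)
open import Data.Nat.Primality using (composite)
open import Data.Nat.Tactic.RingSolver using (solve-∀)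
open import Data.Integer as ℤ using (+_; -[1+_])
import Data.Integer.Properties as ℤₚ
import Data.Integer.Tactic.RingSolver as ℤ-Solver
open import Data.Product using (∃-syntax; _×_; _,_)
open import Relation.Binary.PropositionalEquality using (_≢_; refl; sym; trans; cong; cong₂; subst; module ≡-Reasoning)
open import Relation.Nullary using (contradiction)

pos-∸ : ∀ {m n} → n ≤ m → + (m ∸ n) ≡ + m ℤ.- + n
pos-∸ {m} {n} n≤m = sym (trans (ℤₚ.m-n≡m⊖n m n) (ℤₚ.⊖-≥ n≤m))

fℕ : ℕ → ℕ → ℕ → ℕ → ℕ → ℕ → ℕ
fℕ p q x y z w = x * (p * q) + y * (p′ p * q) + z * (p * p′ q) + w * ((p * q ∸ 1) / 2)

f≡+fℕ : ∀ p q x y z w → f p q (+ x) (+ y) (+ z) (+ w) ≡ + fℕ p q x y z w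
f≡+fℕ p q x y z w = sym
  (trans (pos-+* _ w _) (cong (ℤ._+ _)
  (trans (pos-+* _ z _) (cong (ℤ._+ _)
  (trans (pos-+* _ y _) (cong (ℤ._+ _) (ℤₚ.pos-* x _)))))))
  where
  pos-+* : ∀ m x d → + (m + x * d) ≡ + m ℤ.+ + x ℤ.* + d
  pos-+* m x d = trans (ℤₚ.pos-+ m (x * d)) (cong (ℤ._+_ (+ m)) (ℤₚ.pos-* x d))

f-linear-w : ∀ p q X Y Z W V → f p q X Y Z (W ℤ.+ V) ≡ f p q X Y Z W ℤ.+ V ℤ.* d₃ p q
f-linear-w p q X Y Z W V = linear X Y Z W V (d₀ p q) (d₁ p q) (d₂ p q) (d₃ p q)
  where
  linear : ∀ X Y Z W V D₀ D₁ D₂ D₃ →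
    X ℤ.* D₀ ℤ.+ Y ℤ.* D₁ ℤ.+ Z ℤ.* D₂ ℤ.+ (W ℤ.+ V) ℤ.* D₃
      ≡ X ℤ.* D₀ ℤ.+ Y ℤ.* D₁ ℤ.+ Z ℤ.* D₂ ℤ.+ W ℤ.* D₃ ℤ.+ V ℤ.* D₃
  linear = ℤ-Solver.solve-∀

g₂+[p∸2]d₃≡f : ∀ {p q} κ → 1 ≤ p′ p → 2 ≤ p →
  g₂ p q κ ℤ.+ + (p ∸ 2) ℤ.* d₃ p q ≡ f p q (+ (p′ p ∸ 1)) (+ (p ∸ 1)) (+ κ) (+ 0)
g₂+[p∸2]d₃≡f {p} {q} κ 1≤p′ 2≤p = begin
  g₂ p q κ ℤ.+ + (p ∸ 2) ℤ.* d₃ p q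
    ≡⟨ cong (λ v → g₂ p q κ ℤ.+ v ℤ.* d₃ p q) (pos-∸ 2≤p) ⟩
  g₂ p q κ ℤ.+ (+ p ℤ.- + 2) ℤ.* d₃ p q
    ≡⟨ collect-d₃ (+ p′ p) (+ p) (+ κ) (d₀ p q) (d₁ p q) (d₂ p q) (d₃ p q) ⟩
  f p q (+ p′ p ℤ.- + 1) (+ p ℤ.- + 1) (+ κ) (+ 0)
    ≡⟨ cong₂ (λ X Y → f p q X Y (+ κ) (+ 0)) (pos-∸ 1≤p′) (pos-∸ (≤-trans (n≤1+n 1) 2≤p)) ⟨
  f p q (+ (p′ p ∸ 1)) (+ (p ∸ 1)) (+ κ) (+ 0) ∎
  where
  open ≡-Reasoning
  collect-d₃ : ∀ H P K D₀ D₁ D₂ D₃ →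
    (H ℤ.- + 1) ℤ.* D₀ ℤ.+ (P ℤ.- + 1) ℤ.* D₁ ℤ.+ K ℤ.* D₂ ℤ.+ -[1+ 0 ] ℤ.* D₃
      ℤ.- (P ℤ.- + 3) ℤ.* D₃ ℤ.+ (P ℤ.- + 2) ℤ.* D₃
      ≡ (H ℤ.- + 1) ℤ.* D₀ ℤ.+ (P ℤ.- + 1) ℤ.* D₁ ℤ.+ K ℤ.* D₂ ℤ.+ + 0 ℤ.* D₃
  collect-d₃ = ℤ-Solver.solve-∀

shift-representation-of-g₂ : ∀ {p q κ} x y z w → 1 ≤ p′ p → 2 ≤ p →
  f p q (+ x) (+ y) (+ z) (+ w) ≡ g₂ p q κ →
  fℕ p q x y z (w + (p ∸ 2)) ≡ fℕ p q (p′ p ∸ 1) (p ∸ 1) κ 0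
shift-representation-of-g₂ {p} {q} {κ} x y z w 1≤p′ 2≤p f≡g₂ = ℤₚ.+-injective (begin
  + fℕ p q x y z (w + (p ∸ 2))
    ≡⟨ f≡+fℕ p q x y z (w + (p ∸ 2)) ⟨
  f p q (+ x) (+ y) (+ z) (+ (w + (p ∸ 2)))
    ≡⟨ cong (f p q (+ x) (+ y) (+ z)) (ℤₚ.pos-+ w (p ∸ 2)) ⟩
  f p q (+ x) (+ y) (+ z) (+ w ℤ.+ + (p ∸ 2))
    ≡⟨ f-linear-w p q (+ x) (+ y) (+ z) (+ w) (+ (p ∸ 2)) ⟩
  f p q (+ x) (+ y) (+ z) (+ w) ℤ.+ + (p ∸ 2) ℤ.* d₃ p q
    ≡⟨ cong (ℤ._+ + (p ∸ 2) ℤ.* d₃ p q) f≡g₂ ⟩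
  g₂ p q κ ℤ.+ + (p ∸ 2) ℤ.* d₃ p q
    ≡⟨ g₂+[p∸2]d₃≡f κ 1≤p′ 2≤p ⟩
  f p q (+ (p′ p ∸ 1)) (+ (p ∸ 1)) (+ κ) (+ 0)
    ≡⟨ f≡+fℕ p q (p′ p ∸ 1) (p ∸ 1) κ 0 ⟩
  + fℕ p q (p′ p ∸ 1) (p ∸ 1) κ 0 ∎)
  where open ≡-Reasoning

odd-prime : ∀ {n} → Prime n → 2 < n → ∃[ a ] n ≡ 3 + 2 * a
odd-prime {n} n-prime 2<n with n % 2 | n / 2 | m≡m%n+[m/n]*n n 2 | m%n<n n 2
... | 0           | h     | n≡h*2 | _ =
  contradiction (composite 2<n (divides h n≡h*2)) (Prime.notComposite n-prime)
... | 1           | 0     | refl  | _ = contradiction 2<n λ { (s≤s ()) }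
... | 1           | suc a | refl  | _ = a , odd a
  where
  odd : ∀ a → 1 + (1 + a) * 2 ≡ 3 + 2 * a
  odd = solve-∀
... | suc (suc _) | _     | _     | s≤s (s≤s ())

half-pred : ∀ {n m} → n ≡ 1 + m * 2 → (n ∸ 1) / 2 ≡ m
half-pred {m = m} refl = m*n/n≡m m 2

p′-closed : ∀ a → p′ (3 + 2 * a) ≡ 1 + a
p′-closed a = half-pred (solve a)
  where
  solve : ∀ a → 3 + 2 * a ≡ 1 + (1 + a) * 2
  solve = solve-∀

d₃-closed : ∀ a b → ((3 + 2 * a) * (3 + 2 * b) ∸ 1) / 2 ≡ (1 + a) * (3 + 2 * b) + (1 + b)
d₃-closed a b = half-pred (solve a b)
  where
  solve : ∀ a b → (3 + 2 * a) * (3 + 2 * b) ≡ 1 + ((1 + a) * (3 + 2 * b) + (1 + b)) * 2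
  solve = solve-∀

fℕ-closed : ∀ a b x y z w → let p = 3 + 2 * a; q = 3 + 2 * b in
  fℕ p q x y z w ≡ x * (p * q) + y * ((1 + a) * q) + z * (p * (1 + b)) + w * ((1 + a) * q + (1 + b))
fℕ-closed a b x y z w rewrite p′-closed a | p′-closed b | d₃-closed a b = refl

quotient-excess : ∀ {q c A A₀ B} → c < q → q * A + c ≡ q * A₀ + B →
  ∃[ t ] A ≡ A₀ + t × B ≡ q * t + c
quotient-excess {q} {c} {A} {A₀} {B} c<q eq = A ∸ A₀ , sym A₀+t≡A , B≡qt+c
  where
  A₀≤A : A₀ ≤ A
  A₀≤A = ≮⇒≥ λ A<A₀ → <-irrefl eq (begin-strict
    q * A + c   <⟨ +-monoʳ-< (q * A) c<q ⟩
    q * A + q   ≡⟨ +-comm (q * A) q ⟩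
    q + q * A   ≡⟨ *-suc q A ⟨
    q * suc A   ≤⟨ *-monoʳ-≤ q A<A₀ ⟩
    q * A₀      ≤⟨ m≤m+n (q * A₀) B ⟩
    q * A₀ + B  ∎)
    where open ≤-Reasoning
  A₀+t≡A : A₀ + (A ∸ A₀) ≡ A
  A₀+t≡A = m+[n∸m]≡n A₀≤A
  B≡qt+c : B ≡ q * (A ∸ A₀) + c
  B≡qt+c = +-cancelˡ-≡ (q * A₀) B (q * (A ∸ A₀) + c) (begin
    q * A₀ + B                  ≡⟨ eq ⟨
    q * A + c                   ≡⟨ cong (λ v → q * v + c) A₀+t≡A ⟨
    q * (A₀ + (A ∸ A₀)) + c     ≡⟨ cong (_+ c) (*-distribˡ-+ q A₀ (A ∸ A₀)) ⟩
    q * A₀ + q * (A ∸ A₀) + c   ≡⟨ +-assoc (q * A₀) (q * (A ∸ A₀)) c ⟩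
    q * A₀ + (q * (A ∸ A₀) + c) ∎)
    where open ≡-Reasoning

residue-one-bound : ∀ {p m n M} → p * m + (1 + n) ≡ p * M → p ≤ 1 + n
residue-one-bound {p} {m} {n} {M} eq =
  ∣⇒≤ (∣m+n∣m⇒∣n (divides M (trans eq (*-comm p M))) (m∣m*n m))

square-excess : ∀ {s q t y} → suc s ≤ q → s ≤ t + y → s * s + t ≤ s * y + q * t
square-excess {s} {q} {t} {y} s<q s≤t+y = begin
  s * s + t         ≤⟨ +-monoˡ-≤ t (*-monoʳ-≤ s s≤t+y) ⟩
  s * (t + y) + t   ≡⟨ regroup s t y ⟩
  s * y + suc s * t ≤⟨ +-monoʳ-≤ (s * y) (*-monoˡ-≤ t s<q) ⟩
  s * y + q * t     ∎
  where
  open ≤-Reasoning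
  regroup : ∀ s t y → s * (t + y) + t ≡ s * y + suc s * t
  regroup = solve-∀

carry-equation : ∀ a b k x y z w → let p = 3 + 2 * a; q = 3 + 2 * b in
  fℕ p q x y z (w + (p ∸ 2)) ≡ fℕ p q (p′ p ∸ 1) (p ∸ 1) (suc k) 0 →
  q * (2 * p * x + (2 + 2 * a) * y + p * z + p * w) + (k * p + 2)
    ≡ q * (p * (1 + 2 * a + k) + 1) + (p * z + w)
carry-equation a b k x y z w eq = +-cancelʳ-≡ ((1 + 2 * a) * (p * q + 1)) _ _
  (trans (doubled-lhs a b k x y z w)
  (trans (cong (λ v → 2 * v + (p * z + w + (1 + 2 * a) + (1 + k) * p)) closed-eq)
         (doubled-rhs a b k z w)))
  where
  p = 3 + 2 * a
  q = 3 + 2 * b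
  closed-eq : x * (p * q) + y * ((1 + a) * q) + z * (p * (1 + b)) + (w + (1 + 2 * a)) * ((1 + a) * q + (1 + b))
            ≡ a * (p * q) + (2 + 2 * a) * ((1 + a) * q) + (1 + k) * (p * (1 + b)) + 0 * ((1 + a) * q + (1 + b))
  closed-eq = trans (sym (fℕ-closed a b x y z (w + (1 + 2 * a))))
    (trans eq (trans (cong (λ h → fℕ p q (h ∸ 1) (2 + 2 * a) (suc k) 0) (p′-closed a))
                     (fℕ-closed a b a (2 + 2 * a) (suc k) 0)))
  doubled-lhs : ∀ a b k x y z w → let p = 3 + 2 * a; q = 3 + 2 * b in
    q * (2 * p * x + (2 + 2 * a) * y + p * z + p * w) + (k * p + 2) + (1 + 2 * a) * (p * q + 1)
      ≡ 2 * (x * (p * q) + y * ((1 + a) * q) + z * (p * (1 + b)) + (w + (1 + 2 * a)) * ((1 + a) * q + (1 + b)))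
        + (p * z + w + (1 + 2 * a) + (1 + k) * p)
  doubled-lhs = solve-∀
  doubled-rhs : ∀ a b k z w → let p = 3 + 2 * a; q = 3 + 2 * b in
    2 * (a * (p * q) + (2 + 2 * a) * ((1 + a) * q) + (1 + k) * (p * (1 + b)) + 0 * ((1 + a) * q + (1 + b)))
        + (p * z + w + (1 + 2 * a) + (1 + k) * p)
      ≡ q * (p * (1 + 2 * a + k) + 1) + (p * z + w) + (1 + 2 * a) * (p * q + 1)
  doubled-rhs = solve-∀

no-shifted-representation : ∀ a b k x y z w → let p = 3 + 2 * a; q = 3 + 2 * b in
  k * p + 2 < q → p ≤ q →
  fℕ p q x y z (w + (p ∸ 2)) ≢ fℕ p q (p′ p ∸ 1) (p ∸ 1) (suc k) 0
no-shifted-representation a b k x y z w c<q p≤q eq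
  with t , A≡A₀+t , B≡qt+c ← quotient-excess c<q (carry-equation a b k x y z w eq)
  = <-irrefl refl (begin-strict
    A₀ + t                 <⟨ m<m+n (A₀ + t) (s≤s z≤n) ⟩
    A₀ + t + 2             ≡⟨ A₀+2≡s²+c a k t ⟩
    s * s + t + c          ≤⟨ +-monoˡ-≤ c (square-excess p≤q s≤t+y) ⟩
    s * y + q * t + c      ≡⟨ +-assoc (s * y) (q * t) c ⟩
    s * y + (q * t + c)    ≡⟨ cong (_+_ (s * y)) B≡qt+c ⟨
    s * y + B              ≤⟨ m≤m+n (s * y + B) (2 * p * x + s * w) ⟩
    s * y + B + (2 * p * x + s * w) ≡⟨ A-split a x y z w ⟨
    A                      ≡⟨ A≡A₀+t ⟩
    A₀ + t                 ∎)
  where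
  open ≤-Reasoning
  p = 3 + 2 * a
  q = 3 + 2 * b
  s = 2 + 2 * a
  A = 2 * p * x + s * y + p * z + p * w
  A₀ = p * (1 + 2 * a + k) + 1
  B = p * z + w
  c = k * p + 2
  A+y≡p* : ∀ a x y z w → let p = 3 + 2 * a in
    2 * p * x + (2 + 2 * a) * y + p * z + p * w + y ≡ p * (2 * x + y + z + w)
  A+y≡p* = solve-∀
  A₀+2≡s²+c : ∀ a k t → let p = 3 + 2 * a; s = 2 + 2 * a in
    p * (1 + 2 * a + k) + 1 + t + 2 ≡ s * s + t + (k * p + 2)
  A₀+2≡s²+c = solve-∀
  A-split : ∀ a x y z w → let p = 3 + 2 * a; s = 2 + 2 * a in
    2 * p * x + s * y + p * z + p * w ≡ s * y + (p * z + w) + (2 * p * x + s * w)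
  A-split = solve-∀
  s≤t+y : s ≤ t + y
  s≤t+y = s≤s⁻¹ (residue-one-bound {m = 1 + 2 * a + k} {M = 2 * x + y + z + w} (begin-equality
    p * (1 + 2 * a + k) + (1 + (t + y)) ≡⟨ +-assoc (p * (1 + 2 * a + k)) 1 (t + y) ⟨
    A₀ + (t + y)                        ≡⟨ +-assoc A₀ t y ⟨
    A₀ + t + y                          ≡⟨ cong (_+ y) A≡A₀+t ⟨
    A + y                               ≡⟨ A+y≡p* a x y z w ⟩
    p * (2 * x + y + z + w)             ∎))

carry<q : ∀ {p q k μ} → 2 < p → q ≡ suc k * p + μ → k * p + 2 < q
carry<q {p} {q} {k} {μ} 2<p q≡ = begin-strict
  k * p + 2      <⟨ +-monoʳ-< (k * p) 2<p ⟩
  k * p + p      ≡⟨ +-comm (k * p) p ⟩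
  suc k * p      ≤⟨ m≤m+n (suc k * p) μ ⟩
  suc k * p + μ  ≡⟨ q≡ ⟨
  q              ∎
  where open ≤-Reasoning

proposition8p1 : (p q κ μ : ℕ) → Prime p → Prime q → 2 < p → p < q →
    q ≡ κ * p + μ → 1 ≤ μ → μ ≤ p ∸ 1 → κ + μ < p →
    ¬ Representable p q (g₂ p q κ)
proposition8p1 p q κ μ p-prime q-prime 2<p p<q q≡κp+μ _ μ≤p∸1 _ (x , y , z , w , f≡g₂)
  with odd-prime p-prime 2<p | odd-prime q-prime (<-trans 2<p p<q) | κ
... | a , refl | b , refl | zero =
  <⇒≱ p<q (≤-trans (≤-reflexive q≡κp+μ) (≤-trans μ≤p∸1 (m∸n≤m p 1)))
... | a , refl | b , refl | suc k =
  no-shifted-representation a b k x y z w (carry<q {k = k} 2<p q≡κp+μ) (<⇒≤ p<q)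
    (shift-representation-of-g₂ {3 + 2 * a} {3 + 2 * b} {suc k} x y z w
      (subst (1 ≤_) (sym (p′-closed a)) (s≤s z≤n)) (s≤s (s≤s z≤n)) f≡g₂)
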